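{- Let $\Gamma$ be a distance-biregular graph with color classes $Y,Y'$ such that the eccentricity of the vertices of $Y$ is $D=3$. The following are equivalent: (i) $\Gamma$ is the subdivision graph of a complete graph $K_n$ for some $n\ge 3$; (ii) $k'=2$. Moreover, if (i) and (ii) hold with $Y$ the vertex set of $K_n$, then $\Gamma$ is $2$-$Y$-homogeneous and the intersection array of the color class $Y$ is $(k,1,k-1;1,1,2)$.
   Context: All graphs are finite, simple and connected. $\Gamma_i(x)$ is the set of vertices at distance $i$ from $x$. A vertex $x$ is distance-regularized if for every $i$ the numbers $|\Gamma_{i-1}(x)\cap\Gamma_1(y)|$, $|\Gamma_i(x)\cap\Gamma_1(y)|$, $|\Gamma_{i+1}(x)\cap\Gamma_1(y)|$ depend only on $i$, not on $y\in\Gamma_i(x)$. A distance-biregular graph with color classes $Y,Y'$ is a bipartite graph with bipartition $(Y,Y')$ in which every vertex is distance-regularized, vertices in the same color class have the same intersection numbers, and vertices in different classes have different intersection arrays. $k$ (resp. $k'$) is the valency of vertices of $Y$ (resp. $Y'$). For $x\in Y$, $z\in\Gamma_i(x)$: $c_i=|\Gamma_{i-1}(x)\cap\Gamma_1(z)|$, $b_i=|\Gamma_{i+1}(x)\cap\Gamma_1(z)|$; the intersection array of $Y$ is $(b_0,\dots,b_{D-1};c_1,\dots,c_D)$. The subdivision graph of a graph is obtained by replacing each edge by a path of length $2$; its color classes are the original vertices and the new vertices. $\Gamma$ is $2$-$Y$-homogeneous if for every $i$ with $1\le i\le D-1$ the number $|\Gamma_{i-1}(z)\cap\Gamma_1(x)\cap\Gamma_1(y)|$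 is the same for all $x\in Y$, $y\in\Gamma_2(x)$, $z\in\Gamma_i(x)\cap\Gamma_i(y)$. -}

module Defs where

open import Data.Nat using (ℕ; zero; suc; _+_; _≤_; _<_)
open import Data.Bool using (Bool; true; false; _∧_; _∨_; not; if_then_else_)
open import Data.Fin as Fin using (Fin)
open import Data.Fin.Properties using () renaming (_≟_ to _≟F_)
open import Data.Product using (Σ; ∃; ∃-syntax; _×_; _,_; proj₁; proj₂)
open import Data.Sum using (_⊎_; inj₁; inj₂)
open import Data.Empty using (⊥)
open import Relation.Nullary using (¬_)
open import Relation.Nullary.Decidable using (⌊_⌋)
open import Relation.Binary.PropositionalEquality using (_≡_; _≢_)

count : ∀ {N} → (Fin N → Bool) → ℕ
count {zero}  p = 0
count {suc N} p = (if p Fin.zero then 1 else 0) + count (λ z → p (Fin.suc z))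

anyF : ∀ {N} → (Fin N → Bool) → Bool
anyF {zero}  p = false
anyF {suc N} p = p Fin.zero ∨ anyF (λ z → p (Fin.suc z))

module Walks {N : ℕ} (adj : Fin N → Fin N → Bool) where
  -- reach n x y : there is a walk of length ≤ n from x to y
  reach : ℕ → Fin N → Fin N → Bool
  reach zero    x y = ⌊ x ≟F y ⌋
  reach (suc n) x y = reach n x y ∨ anyF (λ z → reach n x z ∧ adj z y)
  -- isDist i x y : d(x,y) = i, i.e. y ∈ Γ_i(x)
  isDist : ℕ → Fin N → Fin N → Bool
  isDist zero    x y = reach zero x y
  isDist (suc i) x y = reach (suc i) x y ∧ not (reach i x y)
  deg : Fin N → ℕ
  deg x = count (adj x)
  cN : Fin N → ℕ → Fin N → ℕ
  cN x zero    y = 0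
  cN x (suc j) y = count (λ z → isDist j x z ∧ adj y z)
  aN : Fin N → ℕ → Fin N → ℕ
  aN x i y = count (λ z → isDist i x z ∧ adj y z)
  bN : Fin N → ℕ → Fin N → ℕ
  bN x i y = count (λ z → isDist (suc i) x z ∧ adj y z)
  Ecc : Fin N → ℕ → Set
  Ecc x e = (∃[ y ] isDist e x y ≡ true) × (∀ y → reach e x y ≡ true)

record Graph (N : ℕ) : Set where
  field
    adj        : Fin N → Fin N → Bool
    adj-sym    : ∀ x y → adj x y ≡ adj y x
    adj-irrefl : ∀ x → adj x x ≡ false
    connected  : ∀ x y → ∃[ n ] Walks.reach adj n x y ≡ true

module GraphOps {N : ℕ} (G : Graph N) where
  open Graph G public
  open Walks adj public

-- A distance-biregular graph: bipartition given by `color` (true = Y, false = Y').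
record DistanceBiregular {N : ℕ} (G : Graph N) : Set where
  open GraphOps G
  field
    color       : Fin N → Bool
    bipartite   : ∀ x y → adj x y ≡ true → color x ≢ color y
    Y-nonempty  : ∃[ x ] color x ≡ true
    Y'-nonempty : ∃[ x ] color x ≡ false
    D D'        : ℕ
    ecc-Y       : ∀ x → color x ≡ true  → Ecc x D
    ecc-Y'      : ∀ x → color x ≡ false → Ecc x D'
    c a b       : ℕ → ℕ
    c' a' b'    : ℕ → ℕ
    reg-Y  : ∀ x → color x ≡ true → ∀ i y → isDist i x y ≡ true →
             (cN x i y ≡ c i) × (aN x i y ≡ a i) × (bN x i y ≡ b i)
    reg-Y' : ∀ x → color x ≡ false → ∀ i y → isDist i x y ≡ true →
             (cN x i y ≡ c' i) × (aN x i y ≡ a' i) × (bN x i y ≡ b' i)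
    arrays-differ : ¬ ((D ≡ D') × (∀ i → i < D → b i ≡ b' i)
                        × (∀ i → 1 ≤ i → i ≤ D → c i ≡ c' i))

-- Vertices of the subdivision graph S(K_n): original vertices, and one new
-- vertex for each edge {i,j} with i < j.
SV : ℕ → Set
SV n = Fin n ⊎ Σ (Fin n × Fin n) (λ p → proj₁ p Fin.< proj₂ p)

SAdj : ∀ {n} → SV n → SV n → Set
SAdj (inj₁ v) (inj₁ w) = ⊥
SAdj (inj₁ v) (inj₂ ((i , j) , _)) = (v ≡ i) ⊎ (v ≡ j)
SAdj (inj₂ ((i , j) , _)) (inj₁ v) = (v ≡ i) ⊎ (v ≡ j)
SAdj (inj₂ e) (inj₂ f) = ⊥

isOriginal : ∀ {n} → SV n → Bool
isOriginal (inj₁ _) = true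
isOriginal (inj₂ _) = false

TwoYHomogeneous : ∀ {N} {G : Graph N} → DistanceBiregular G → Set
TwoYHomogeneous {N} {G} Δ =
  ∀ i → 1 ≤ i → suc i ≤ D →
    ∃[ γ ] (∀ x y z → color x ≡ true → isDist 2 x y ≡ true →
              isDist i x z ≡ true → isDist i y z ≡ true →
              count (λ w → isDistPred i z w ∧ adj x w ∧ adj y w) ≡ γ)
  where
    open GraphOps G
    open DistanceBiregular Δ
    isDistPred : ℕ → Fin N → Fin N → Bool
    isDistPred zero    _ _ = false
    isDistPred (suc j) z w = isDist j z w

-- A Y-vertex has eccentricity 3 and Γ is bipartite, so two distinct Y-vertices are at
-- distance 2 and a Y'-vertex is at distance 1 or 3 from every Y-vertex.  Suppose k' = 2.
-- A geodesic x z t w from a Y-vertex x exhibits two Y'-vertices z, w at distance 2 whose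
-- only common neighbour is t, so c'₂ = 1; hence two Y'-vertices with the same pair of
-- neighbours coincide (they would give c'₂ = 2).  Since any two Y-vertices do have a common
-- neighbour, Y'-vertices correspond to the pairs of Y-vertices: Γ is the subdivision of the
-- complete graph on Y, and the intersection numbers are read off along the same geodesic.
-- Conversely, in the subdivision of K_n two subdivision vertices of disjoint edges are at
-- distance 4.  So an original vertex lying in Y' (whose neighbours lie in Y and have
-- eccentricity 3) forces n = 3, where it has valency 2, as every subdivision vertex has.

module Submission where

open import Defs
open import Data.Nat using (ℕ; zero; suc; _+_; _∸_; _≤_; z≤n; s≤s)
open import Data.Nat.Properties
  using ( +-suc; suc-injective; ≤-refl; ≤-trans; ≤-antisym; m≤n⇒m≤1+n; 1+n≰n; 1+n≢n; m+n∸m≡n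
        ; m≢1+m+n; ≰⇒>; _≤?_)
open import Data.Nat.GeneralisedArithmetic using (fold)
open import Data.Bool using (Bool; true; false; _∧_; _∨_; not)
open import Data.Bool.Properties
  using (∧-conicalˡ; ∧-conicalʳ; ∧-zeroʳ; ∧-identityʳ; ∧-idem; ∧-comm; ∨-zeroʳ; ¬-not; T-≡; ⇔→≡)
open import Data.Fin as Fin using (Fin; zero; suc; punchIn)
open import Data.Fin.Properties
  using (_≟_; <-cmp; <-asym; <-irrelevant; <⇒≢; injective⇒≤; punchInᵢ≢i; punchIn-injective)
open import Data.Product as Product using (Σ; ∃-syntax; _×_; _,_; proj₁; proj₂)
open import Data.Sum as Sum using (_⊎_; inj₁; inj₂)
open import Data.Sum.Properties using (inj₁-injective; inj₂-injective)
open import Data.Empty using (⊥; ⊥-elim)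
import Data.Empty.Irrelevant as Irrelevant
open import Function using (_∘_; id; case_of_)
open import Function.Bundles using (_⇔_; mk⇔; Equivalence; _⤖_; mk⤖; Bijection; Surjection)
open import Relation.Binary using (tri<; tri≈; tri>)
open import Relation.Nullary using (yes; no)
open import Relation.Nullary.Decidable using (⌊_⌋; toWitness)
open import Relation.Binary.PropositionalEquality

private variable
  N n : ℕ
  A B : Set

∨≡true : ∀ {x y} → x ∨ y ≡ true → x ≡ true ⊎ y ≡ true
∨≡true {true}  _ = inj₁ refl
∨≡true {false} e = inj₂ e

not-both : ∀ {x} → x ≡ true → not x ≡ true → ⊥
not-both refl ()

∧≡true : ∀ {x y} → x ∧ y ≡ true → x ≡ true × y ≡ true
∧≡true {x} {y} e = ∧-conicalˡ x y e , ∧-conicalʳ x y e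

∧≡false : ∀ {x y} → (x ≡ true → y ≡ true → ⊥) → x ∧ y ≡ false
∧≡false f = ¬-not (λ e → let x , y = ∧≡true e in f x y)

≢⇒≟ : ∀ {x y : Fin N} → x ≢ y → ⌊ x ≟ y ⌋ ≡ false
≢⇒≟ x≢y = cong ⌊_⌋ (≢-≟-identity _≟_ x≢y)

_∖_ : (Fin N → Bool) → Fin N → Fin N → Bool
(p ∖ a) w = p w ∧ not ⌊ w ≟ a ⌋

count-cong : {p q : Fin N → Bool} → (∀ w → p w ≡ q w) → count p ≡ count q
count-cong {zero}          p≗q = refl
count-cong {suc N} {p} {q} p≗q rewrite p≗q zero = cong (_ +_) (count-cong (p≗q ∘ suc))

count-none : {p : Fin N → Bool} → (∀ w → p w ≡ false) → count p ≡ 0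
count-none {zero}      none = refl
count-none {suc N} {p} none rewrite none zero = count-none (none ∘ suc)

count-witness : ∀ {k} (p : Fin N → Bool) → count p ≡ suc k → ∃[ a ] p a ≡ true
count-witness {suc N} p h with p zero in e
... | true  = zero , e
... | false = Product.map suc id (count-witness (p ∘ suc) h)

count-split : (p q : Fin N → Bool) →
              count p ≡ count (λ w → p w ∧ q w) + count (λ w → p w ∧ not (q w))
count-split {zero}  p q = refl
count-split {suc N} p q with p zero | q zero | count-split (p ∘ suc) (q ∘ suc)
... | true  | true  | ih = cong suc ih
... | true  | false | ih = trans (cong suc ih) (sym (+-suc _ _))
... | false | _     | ih = ih

count-≟ : (a : Fin N) → count (λ w → ⌊ w ≟ a ⌋) ≡ 1
count-≟ {suc N} zero = cong suc (count-none {N} (λ _ → refl))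
count-≟ {suc N} (suc a) = trans (count-cong ≟-suc) (count-≟ a)
  where
  ≟-suc : ∀ w → ⌊ suc w ≟ suc a ⌋ ≡ ⌊ w ≟ a ⌋
  ≟-suc w with w ≟ a
  ... | yes _ = refl
  ... | no _  = refl

count-remove : (p : Fin N → Bool) {a : Fin N} → p a ≡ true → count p ≡ suc (count (p ∖ a))
count-remove p {a} pa = trans (count-split p (λ w → ⌊ w ≟ a ⌋))
                              (cong (_+ count (p ∖ a)) (trans (count-cong at-a) (count-≟ a)))
  where
  at-a : ∀ w → p w ∧ ⌊ w ≟ a ⌋ ≡ ⌊ w ≟ a ⌋
  at-a w with w ≟ a
  ... | yes refl = trans (∧-identityʳ (p w)) pa
  ... | no _     = ∧-zeroʳ (p w)

∖-intro : (p : Fin N → Bool) {a w : Fin N} → p w ≡ true → w ≢ a → (p ∖ a) w ≡ true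
∖-intro p pw w≢a = cong₂ _∧_ pw (cong not (≢⇒≟ w≢a))

∖-elim : (p : Fin N → Bool) {a w : Fin N} → (p ∖ a) w ≡ true → p w ≡ true × w ≢ a
∖-elim p {a} {w} e with w ≟ a | ∧≡true {p w} e
... | no w≢a | pw , _ = pw , w≢a

count≡0 : (p : Fin N → Bool) {w : Fin N} → count p ≡ 0 → p w ≡ true → ⊥
count≡0 p c pw with () ← trans (sym c) (count-remove p pw)

count≡1 : {p : Fin N → Bool} {a : Fin N} → p a ≡ true → (∀ w → p w ≡ true → w ≡ a) → count p ≡ 1
count≡1 {p = p} {a} pa only = trans (count-remove p pa) (cong suc (count-none none))
  where
  none : ∀ w → (p ∖ a) w ≡ false
  none w = ¬-not λ e → let pw , w≢a = ∖-elim p e in w≢a (only w pw)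

count≡1-unique : (p : Fin N → Bool) {a w : Fin N} → count p ≡ 1 → p a ≡ true → p w ≡ true → w ≡ a
count≡1-unique p {a} {w} c pa pw with w ≟ a
... | yes w≡a = w≡a
... | no w≢a  = ⊥-elim (count≡0 (p ∖ a) (suc-injective (trans (sym (count-remove p pa)) c)) (∖-intro p pw w≢a))

record Exactly₂ (p : Fin N → Bool) (a b : Fin N) : Set where
  constructor exactly₂
  field
    distinct : a ≢ b
    holds₁   : p a ≡ true
    holds₂   : p b ≡ true
    only     : ∀ w → p w ≡ true → w ≡ a ⊎ w ≡ b

count-exactly₂ : {p : Fin N → Bool} {a b : Fin N} → Exactly₂ p a b → count p ≡ 2
count-exactly₂ {p = p} {a} {b} (exactly₂ a≢b pa pb only) =
  trans (count-remove p pa) (cong suc (count≡1 (∖-intro p pb (a≢b ∘ sym)) only∖a))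
  where
  only∖a : ∀ w → (p ∖ a) w ≡ true → w ≡ b
  only∖a w e with ∖-elim p e
  ... | pw , w≢a with only w pw
  ... | inj₁ w≡a = ⊥-elim (w≢a w≡a)
  ... | inj₂ w≡b = w≡b

count≡2-other : {p : Fin N → Bool} {a : Fin N} → count p ≡ 2 → p a ≡ true → ∃[ b ] Exactly₂ p a b
count≡2-other {p = p} {a} c pa =
  b , exactly₂ (λ a≡b → b≢a (sym a≡b)) pa pb only
  where
  c∖a : count (p ∖ a) ≡ 1
  c∖a = suc-injective (trans (sym (count-remove p pa)) c)
  b : Fin _
  b = proj₁ (count-witness (p ∖ a) c∖a)
  pb∖a : (p ∖ a) b ≡ true
  pb∖a = proj₂ (count-witness (p ∖ a) c∖a)
  pb : p b ≡ true
  pb = proj₁ (∖-elim p pb∖a)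
  b≢a : b ≢ a
  b≢a = proj₂ (∖-elim p pb∖a)
  only : ∀ w → p w ≡ true → w ≡ a ⊎ w ≡ b
  only w pw with w ≟ a
  ... | yes w≡a = inj₁ w≡a
  ... | no w≢a  = inj₂ (count≡1-unique (p ∖ a) c∖a pb∖a (∖-intro p pw w≢a))

count≡2-exactly₂ : {p : Fin N → Bool} {a b : Fin N} → count p ≡ 2 → a ≢ b → p a ≡ true → p b ≡ true →
                   Exactly₂ p a b
count≡2-exactly₂ c a≢b pa pb with count≡2-other c pa
... | b' , exactly₂ _ _ _ only with only _ pb
...   | inj₁ b≡a  = ⊥-elim (a≢b (sym b≡a))
...   | inj₂ refl = exactly₂ a≢b pa pb only

record Enumeration (p : Fin N → Bool) : Set where
  field
    size          : ℕ
    index         : (x : Fin N) → .(p x ≡ true) → Fin size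
    element       : Fin size → Fin N
    element-holds : ∀ i → p (element i) ≡ true
    index-element : ∀ i → index (element i) (element-holds i) ≡ i
    element-index : ∀ x .(px : p x ≡ true) → element (index x px) ≡ x

  index-injective : ∀ {x y} .{px : p x ≡ true} .{py : p y ≡ true} → index x px ≡ index y py → x ≡ y
  index-injective {x} {y} {px} {py} eq =
    trans (sym (element-index x px)) (trans (cong element eq) (element-index y py))

  index-cong : ∀ {x y} .{px : p x ≡ true} .{py : p y ≡ true} → x ≡ y → index x px ≡ index y py
  index-cong refl = refl

  element-injective : ∀ {i j} → element i ≡ element j → i ≡ j
  element-injective {i} {j} eq = trans (sym (index-element i)) (trans (index-cong eq) (index-element j))

enumerate : (p : Fin N → Bool) → Enumeration p
enumerate {zero}  p = record
  { size = 0 ; index = λ () ; element = λ () ; element-holds = λ ()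
  ; index-element = λ () ; element-index = λ () }
enumerate {suc N} p with p zero in p0 | enumerate (p ∘ suc)
... | true  | E = record
  { size = suc size ; index = index′ ; element = element′ ; element-holds = holds′
  ; index-element = index-element′ ; element-index = element-index′ }
  where
  open Enumeration E
  index′ : (x : Fin (suc N)) → .(p x ≡ true) → Fin (suc size)
  index′ zero    _  = zero
  index′ (suc x) px = suc (index x px)
  element′ : Fin (suc size) → Fin (suc N)
  element′ zero    = zero
  element′ (suc i) = suc (element i)
  holds′ : ∀ i → p (element′ i) ≡ true
  holds′ zero    = p0
  holds′ (suc i) = element-holds i
  index-element′ : ∀ i → index′ (element′ i) (holds′ i) ≡ i
  index-element′ zero    = refl
  index-element′ (suc i) = cong suc (index-element i)
  element-index′ : ∀ x .(px : p x ≡ true) → element′ (index′ x px) ≡ x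
  element-index′ zero    _  = refl
  element-index′ (suc x) px = cong suc (element-index x px)
... | false | E = record
  { size = size ; index = index′ ; element = suc ∘ element ; element-holds = element-holds
  ; index-element = index-element ; element-index = element-index′ }
  where
  open Enumeration E
  index′ : (x : Fin (suc N)) → .(p x ≡ true) → Fin size
  index′ zero    p0′ = Irrelevant.⊥-elim (not-both p0′ (cong not p0))
  index′ (suc x) px  = index x px
  element-index′ : ∀ x .(px : p x ≡ true) → suc (element (index′ x px)) ≡ x
  element-index′ zero    p0′ = Irrelevant.⊥-elim (not-both p0′ (cong not p0))
  element-index′ (suc x) px  = cong suc (element-index x px)

anyF-intro : (p : Fin N → Bool) {z : Fin N} → p z ≡ true → anyF p ≡ true
anyF-intro p {zero}  pz rewrite pz = refl
anyF-intro p {suc z} pz = trans (cong (p zero ∨_) (anyF-intro (p ∘ suc) pz)) (∨-zeroʳ _)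

anyF-witness : (p : Fin N → Bool) → anyF p ≡ true → ∃[ z ] p z ≡ true
anyF-witness {suc N} p e with p zero in pz
... | true  = zero , pz
... | false = Product.map suc id (anyF-witness (p ∘ suc) e)

infixl 5 _▷_

data Walk (R : A → A → Set) : ℕ → A → A → Set where
  []  : ∀ {x} → Walk R 0 x x
  _▷_ : ∀ {m x y z} → Walk R m x y → R y z → Walk R (suc m) x z

walk-map : {R : A → A → Set} {S : B → B → Set} (f : A → B) → (∀ {x y} → R x y → S (f x) (f y)) →
           ∀ {m x y} → Walk R m x y → Walk S m (f x) (f y)
walk-map f hom []      = []
walk-map f hom (w ▷ r) = walk-map f hom w ▷ hom r

alternating-walk : {R : A → A → Set} (col : A → Bool) → (∀ {x y} → R x y → col y ≡ not (col x)) →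
                   ∀ {m x y} → Walk R m x y → col y ≡ fold (col x) not m
alternating-walk col alt []      = refl
alternating-walk col alt (w ▷ r) = trans (alt r) (cong not (alternating-walk col alt w))

module Distances {N : ℕ} (G : Graph N) where
  open GraphOps G

  Adj : Fin N → Fin N → Set
  Adj x y = adj x y ≡ true

  isDist-0 : ∀ {x y} → isDist 0 x y ≡ true → x ≡ y
  isDist-0 d = toWitness (Equivalence.from T-≡ d)

  isDist-0-refl : ∀ {x} → isDist 0 x x ≡ true
  isDist-0-refl = cong ⌊_⌋ (≡-≟-identity _≟_ refl)

  walk⇒reach : ∀ {m n x y} → Walk Adj m x y → m ≤ n → reach n x y ≡ true
  walk⇒reach {n = zero}          []      z≤n = isDist-0-refl
  walk⇒reach {m} {suc n} {x} {y} w m≤1+n with m ≤? n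
  ... | yes m≤n = cong (_∨ anyF (λ z → reach n x z ∧ adj z y)) (walk⇒reach w m≤n)
  walk⇒reach {n = suc n} []      _         | no 0≰n = ⊥-elim (0≰n z≤n)
  walk⇒reach {n = suc n} {x} {y} (w ▷ a) (s≤s m≤n) | no _ =
    trans (cong (reach n x y ∨_) (anyF-intro (λ z → reach n x z ∧ adj z y) (cong₂ _∧_ (walk⇒reach w m≤n) a)))
          (∨-zeroʳ (reach n x y))

  reach⇒walk : ∀ {n x y} → reach n x y ≡ true → ∃[ m ] m ≤ n × Walk Adj m x y
  reach⇒walk {zero} {x} e = 0 , z≤n , subst (Walk Adj 0 x) (isDist-0 e) []
  reach⇒walk {suc n} {x} {y} e with ∨≡true {reach n x y} e
  ... | inj₁ r = Product.map₂ (Product.map₁ m≤n⇒m≤1+n) (reach⇒walk r)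
  ... | inj₂ a with anyF-witness (λ z → reach n x z ∧ adj z y) a
  ...   | z , r∧a with ∧≡true {reach n x z} r∧a
  ...     | r , az with reach⇒walk r
  ...       | m , m≤n , w = suc m , s≤s m≤n , w ▷ az

  isDist-minimal : ∀ {i m x y} → isDist i x y ≡ true → Walk Adj m x y → i ≤ m
  isDist-minimal {zero}      _ _ = z≤n
  isDist-minimal {suc i} {m} d w with m ≤? i | ∧≡true d
  ... | yes m≤i | _ , unreached = ⊥-elim (not-both (walk⇒reach w m≤i) unreached)
  ... | no m≰i  | _             = ≰⇒> m≰i

  isDist⇒reach : ∀ {i x y} → isDist i x y ≡ true → reach i x y ≡ true
  isDist⇒reach {zero}  d = d
  isDist⇒reach {suc i} d = proj₁ (∧≡true d)

  isDist⇒walk : ∀ {i x y} → isDist i x y ≡ true → Walk Adj i x y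
  isDist⇒walk {i} {x} {y} d with reach⇒walk (isDist⇒reach {i} d)
  ... | m , m≤i , w = subst (λ k → Walk Adj k x y) (≤-antisym m≤i (isDist-minimal d w)) w

  geodesic⇒isDist : ∀ {i x y} → Walk Adj i x y → (∀ {m} → Walk Adj m x y → i ≤ m) → isDist i x y ≡ true
  geodesic⇒isDist {zero}  w _       = walk⇒reach {n = 0} w z≤n
  geodesic⇒isDist {suc i} w minimal = cong₂ _∧_ (walk⇒reach w ≤-refl) (cong not (¬-not unreached))
    where
    unreached : reach i _ _ ≢ true
    unreached r with reach⇒walk r
    ... | m , m≤i , w' = 1+n≰n (≤-trans (minimal w') m≤i)

  isDist-unique : ∀ {i j x y} → isDist i x y ≡ true → isDist j x y ≡ true → i ≡ j
  isDist-unique di dj = ≤-antisym (isDist-minimal di (isDist⇒walk dj)) (isDist-minimal dj (isDist⇒walk di))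

  reach⇒isDist : ∀ {n x y} → reach n x y ≡ true → ∃[ d ] d ≤ n × isDist d x y ≡ true
  reach⇒isDist {zero}          r = 0 , z≤n , r
  reach⇒isDist {suc n} {x} {y} r with reach n x y in r'
  ... | true  = Product.map₂ (Product.map₁ m≤n⇒m≤1+n) (reach⇒isDist r')
  ... | false = suc n , ≤-refl , cong₂ _∧_ (trans (cong (_∨ anyF (λ z → reach n x z ∧ adj z y)) r') r) (cong not r')

  isDist-1 : ∀ {x y} → isDist 1 x y ≡ adj x y
  isDist-1 = ⇔→≡ (mk⇔ (λ d → single-step (isDist⇒walk d)) (λ a → geodesic⇒isDist ([] ▷ a) (no-loop a)))
    where
    single-step : ∀ {x y} → Walk Adj 1 x y → Adj x y
    single-step ([] ▷ a) = a
    no-loop : ∀ {x y m} → Adj x y → Walk Adj m x y → 1 ≤ m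
    no-loop {x} a []      = ⊥-elim (not-both a (cong not (adj-irrefl x)))
    no-loop     a (_ ▷ _) = s≤s z≤n

  isDist-suc⇒≢ : ∀ {i x y} → isDist (suc i) x y ≡ true → x ≢ y
  isDist-suc⇒≢ {i} {x} d refl with () ← isDist-unique {0} {suc i} {x} {x} isDist-0-refl d

  isDist-2 : ∀ {x y z} → x ≢ y → adj x y ≡ false → Adj x z → Adj z y → isDist 2 x y ≡ true
  isDist-2 {x} {y} x≢y x≁y xz zy = geodesic⇒isDist ([] ▷ xz ▷ zy) minimal
    where
    minimal : ∀ {m} → Walk Adj m x y → 2 ≤ m
    minimal []          = ⊥-elim (x≢y refl)
    minimal ([] ▷ xy)   = ⊥-elim (not-both xy (cong not x≁y))
    minimal (_ ▷ _ ▷ _) = s≤s (s≤s z≤n)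

  Ecc-unique : ∀ {x} e e' → Ecc x e → Ecc x e' → e ≡ e'
  Ecc-unique _ _ ((y , dy) , reach-e) ((y' , dy') , reach-e') =
    ≤-antisym (bounded dy (reach-e' y)) (bounded dy' (reach-e y'))
    where
    bounded : ∀ {e e' x y} → isDist e x y ≡ true → reach e' x y ≡ true → e ≤ e'
    bounded d r with reach⇒isDist r
    ... | _ , d'≤e' , q = subst (_≤ _) (sym (isDist-unique d q)) d'≤e'

three-distinct⇒3≤ : ∀ {i j k : Fin n} → i ≢ j → i ≢ k → j ≢ k → 3 ≤ n
three-distinct⇒3≤ {n} {i} {j} {k} i≢j i≢k j≢k = injective⇒≤ {f = f} f-injective
  where
  f : Fin 3 → Fin n
  f zero             = i
  f (suc zero)       = j
  f (suc (suc zero)) = k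
  f-injective : ∀ {a b} → f a ≡ f b → a ≡ b
  f-injective {zero}             {zero}             _  = refl
  f-injective {suc zero}         {suc zero}         _  = refl
  f-injective {suc (suc zero)}   {suc (suc zero)}   _  = refl
  f-injective {zero}             {suc zero}         eq = ⊥-elim (i≢j eq)
  f-injective {zero}             {suc (suc zero)}   eq = ⊥-elim (i≢k eq)
  f-injective {suc zero}         {suc (suc zero)}   eq = ⊥-elim (j≢k eq)
  f-injective {suc zero}         {zero}             eq = ⊥-elim (i≢j (sym eq))
  f-injective {suc (suc zero)}   {zero}             eq = ⊥-elim (i≢k (sym eq))
  f-injective {suc (suc zero)}   {suc zero}         eq = ⊥-elim (j≢k (sym eq))

two-others : 3 ≤ n → (i : Fin n) → ∃[ j ] ∃[ k ] i ≢ j × i ≢ k × j ≢ k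
two-others (s≤s (s≤s (s≤s _))) i =
  punchIn i zero , punchIn i (suc zero) , punchInᵢ≢i i _ ∘ sym , punchInᵢ≢i i _ ∘ sym ,
  (λ ()) ∘ punchIn-injective i zero (suc zero)

Edge : ℕ → Set
Edge n = Σ (Fin n × Fin n) (λ (i , j) → i Fin.< j)

_∈ₑ_ : Fin n → Edge n → Set
v ∈ₑ e = SAdj (inj₁ v) (inj₂ e)

SAdj-sym : {s t : SV n} → SAdj s t → SAdj t s
SAdj-sym {s = inj₁ _} {inj₂ _} h = h
SAdj-sym {s = inj₂ _} {inj₁ _} h = h

edge : (i j : Fin n) → .(i ≢ j) → Edge n
edge i j i≢j with <-cmp i j
... | tri< i<j _ _   = (i , j) , i<j
... | tri≈ _ i≡j _   = Irrelevant.⊥-elim (i≢j i≡j)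
... | tri> _ _ j<i   = (j , i) , j<i

∈-edge : ∀ {i j v : Fin n} .(i≢j : i ≢ j) → v ∈ₑ edge i j i≢j ⇔ (v ≡ i ⊎ v ≡ j)
∈-edge {i = i} {j} i≢j with <-cmp i j
... | tri< _ _ _   = mk⇔ id id
... | tri≈ _ i≡j _ = Irrelevant.⊥-elim (i≢j i≡j)
... | tri> _ _ _   = mk⇔ Sum.swap Sum.swap

edge-unique : ∀ {a b : Fin n} (a≢b : a ≢ b) {e : Edge n} → a ∈ₑ e → b ∈ₑ e → e ≡ edge a b a≢b
edge-unique {a = a} {b} a≢b {(p , q) , p<q} a∈e b∈e with a∈e | b∈e | <-cmp a b
... | inj₁ refl | inj₁ refl | _            = ⊥-elim (a≢b refl)
... | inj₂ refl | inj₂ refl | _            = ⊥-elim (a≢b refl)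
... | _         | _         | tri≈ _ a≡b _ = ⊥-elim (a≢b a≡b)
... | inj₁ refl | inj₂ refl | tri< a<b _ _ = cong (_ ,_) (<-irrelevant p<q a<b)
... | inj₁ refl | inj₂ refl | tri> _ _ b<a = ⊥-elim (<-asym p<q b<a)
... | inj₂ refl | inj₁ refl | tri< a<b _ _ = ⊥-elim (<-asym p<q a<b)
... | inj₂ refl | inj₁ refl | tri> _ _ b<a = cong (_ ,_) (<-irrelevant p<q b<a)

SAdj-alternates : {s t : SV n} → SAdj s t → isOriginal t ≡ not (isOriginal s)
SAdj-alternates {s = inj₁ _} {inj₂ _} _ = refl
SAdj-alternates {s = inj₂ _} {inj₁ _} _ = refl

edge-vertices-far : ∀ {m} {e e' : Edge n} → (∀ {v} → v ∈ₑ e → v ∈ₑ e' → ⊥) →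
                    Walk SAdj m (inj₂ e) (inj₂ e') → m ≤ 3 → ⊥
edge-vertices-far disjoint [] _ = disjoint (inj₁ refl) (inj₁ refl)
edge-vertices-far disjoint w@([] ▷ _) _ with () ← alternating-walk isOriginal SAdj-alternates w
edge-vertices-far {e = e} {e'} disjoint ([] ▷ h₁ ▷ h₂) _ = no-common-end h₁ h₂
  where
  no-common-end : ∀ {s} → SAdj (inj₂ e) s → SAdj s (inj₂ e') → ⊥
  no-common-end {inj₁ v} h₁ h₂ = disjoint (SAdj-sym {s = inj₂ e} {inj₁ v} h₁) h₂
edge-vertices-far disjoint w@([] ▷ _ ▷ _ ▷ _) _ with () ← alternating-walk isOriginal SAdj-alternates w
edge-vertices-far disjoint (_ ▷ _ ▷ _ ▷ _ ▷ _) (s≤s (s≤s (s≤s ())))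

edge-vertex-neighbours : ∀ {i j : Fin n} {i<j} {u} → SAdj (inj₂ ((i , j) , i<j)) u ⇔ (u ≡ inj₁ i ⊎ u ≡ inj₁ j)
edge-vertex-neighbours {u = inj₁ _} =
  mk⇔ (Sum.map (cong inj₁) (cong inj₁)) λ { (inj₁ refl) → inj₁ refl ; (inj₂ refl) → inj₂ refl }
edge-vertex-neighbours {u = inj₂ _} = mk⇔ (λ ()) λ { (inj₁ ()) ; (inj₂ ()) }

original-neighbour : ∀ {i : Fin n} {u} → SAdj (inj₁ i) u → ∃[ o ] Σ (i ≢ o) λ i≢o → u ≡ inj₂ (edge i o i≢o)
original-neighbour {u = inj₂ ((p , q) , p<q)} (inj₁ refl) =
  q , <⇒≢ p<q , cong inj₂ (edge-unique (<⇒≢ p<q) (inj₁ refl) (inj₂ refl))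
original-neighbour {u = inj₂ ((p , q) , p<q)} (inj₂ refl) =
  p , <⇒≢ p<q ∘ sym , cong inj₂ (edge-unique (<⇒≢ p<q ∘ sym) (inj₂ refl) (inj₁ refl))

module Eccentricity₃ {N : ℕ} (G : Graph N) (Δ : DistanceBiregular G)
                     (ecc₃ : ∀ x → DistanceBiregular.color Δ x ≡ true → GraphOps.Ecc G x 3) where
  open GraphOps G
  open DistanceBiregular Δ
  open Distances G

  adj-color : ∀ {x y} → Adj x y → color y ≡ not (color x)
  adj-color {x} {y} xy = ¬-not (λ eq → bipartite x y xy (sym eq))

  same-color⇒nonadjacent : ∀ {x y} → color x ≡ color y → adj x y ≡ false
  same-color⇒nonadjacent {x} {y} eq = ¬-not (λ xy → bipartite x y xy eq)

  Y-neighbour : ∀ {x z} → color x ≡ true → Adj x z → color z ≡ false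
  Y-neighbour ex xz = trans (adj-color xz) (cong not ex)

  Y'-neighbour : ∀ {z x} → color z ≡ false → Adj z x → color x ≡ true
  Y'-neighbour ez zx = trans (adj-color zx) (cong not ez)

  color-at-distance : ∀ d {x u} → color x ≡ true → isDist d x u ≡ true → color u ≡ fold true not d
  color-at-distance d ex du =
    trans (alternating-walk color adj-color (isDist⇒walk {d} du)) (cong (λ c → fold c not d) ex)

  Y-Y-distance : ∀ {x u} → color x ≡ true → color u ≡ true → x ≢ u → isDist 2 x u ≡ true
  Y-Y-distance {x} {u} ex eu x≢u with reach⇒isDist {3} {x} {u} (proj₂ (ecc₃ x ex) u)
  ... | 0 , _ , du = ⊥-elim (x≢u (isDist-0 du))
  ... | 1 , _ , du with () ← trans (sym eu) (color-at-distance 1 ex du)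
  ... | 2 , _ , du = du
  ... | 3 , _ , du with () ← trans (sym eu) (color-at-distance 3 ex du)
  ... | suc (suc (suc (suc _))) , s≤s (s≤s (s≤s ())) , _

  Y-Y'-distance : ∀ {x u} → color x ≡ true → color u ≡ false → isDist 1 x u ≡ true ⊎ isDist 3 x u ≡ true
  Y-Y'-distance {x} {u} ex eu with reach⇒isDist {3} {x} {u} (proj₂ (ecc₃ x ex) u)
  ... | 0 , _ , du with () ← trans (sym eu) (color-at-distance 0 ex du)
  ... | 1 , _ , du = inj₁ du
  ... | 2 , _ , du with () ← trans (sym eu) (color-at-distance 2 ex du)
  ... | 3 , _ , du = inj₂ du
  ... | suc (suc (suc (suc _))) , s≤s (s≤s (s≤s ())) , _

  D≡3 : D ≡ 3
  D≡3 = let x , ex = Y-nonempty in Ecc-unique D 3 (ecc-Y x ex) (ecc₃ x ex)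

  record Geodesic₃ (x : Fin N) : Set where
    field
      {z t w} : Fin N
      xz      : Adj x z
      zt      : Adj z t
      tw      : Adj t w
      x-w     : isDist 3 x w ≡ true

    x≁w : adj x w ≡ false
    x≁w = ¬-not λ xw → m≢1+m+n 1 (isDist-unique {1} {3} {x} {w} (trans isDist-1 xw) x-w)

    t≢x : t ≢ x
    t≢x t≡x = not-both (subst (λ s → Adj s w) t≡x tw) (cong not x≁w)

  geodesic₃ : ∀ {x} → color x ≡ true → Geodesic₃ x
  geodesic₃ {x} ex with proj₁ (ecc₃ x ex)
  ... | _ , dw with isDist⇒walk {3} {x} dw
  ...   | [] ▷ xz ▷ zt ▷ tw = record { xz = xz ; zt = zt ; tw = tw ; x-w = dw }

  module FromSubdivision {n} (3≤n : 3 ≤ n) (φ : Fin N ⤖ SV n)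
                         (φ-adj : ∀ x y → Adj x y ⇔ SAdj (Bijection.to φ x) (Bijection.to φ y)) where
    open Bijection φ using (to; injective; to⁻; surjection)
    open Surjection surjection using (to∘to⁻)

    valency-2 : ∀ {y v s t} → to y ≡ v → s ≢ t → (∀ {u} → SAdj v u ⇔ (u ≡ s ⊎ u ≡ t)) → deg y ≡ 2
    valency-2 {y} {s = s} {t} refl s≢t nbhd =
      count-exactly₂ (exactly₂ (s≢t ∘ to⁻-injective) (adjacent (inj₁ refl)) (adjacent (inj₂ refl)) only)
      where
      to⁻-injective : to⁻ s ≡ to⁻ t → s ≡ t
      to⁻-injective eq = trans (sym (to∘to⁻ s)) (trans (cong to eq) (to∘to⁻ t))
      adjacent : ∀ {r} → r ≡ s ⊎ r ≡ t → Adj y (to⁻ r)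
      adjacent {r} h = Equivalence.from (φ-adj y (to⁻ r)) (subst (SAdj (to y)) (sym (to∘to⁻ r)) (Equivalence.from nbhd h))
      only : ∀ u → Adj y u → u ≡ to⁻ s ⊎ u ≡ to⁻ t
      only u yu = Sum.map preimage preimage (Equivalence.to nbhd (Equivalence.to (φ-adj y u) yu))
        where
        preimage : ∀ {r} → to u ≡ r → u ≡ to⁻ r
        preimage {r} eq = injective (trans eq (sym (to∘to⁻ r)))

    disjoint-edges-near : ∀ {y i j k o} (i≢j : i ≢ j) (k≢o : k ≢ o) → color y ≡ false → to y ≡ inj₁ i →
                          (∀ {v} → v ∈ₑ edge i j i≢j → v ∈ₑ edge k o k≢o → ⊥) → ⊥
    disjoint-edges-near {y} {i} {j} {k} {o} i≢j k≢o ey ty disjoint with reach⇒walk {3} {x} {x'} (proj₂ (ecc₃ x ex) x')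
      where
      x x' : Fin N
      x  = to⁻ (inj₂ (edge i j i≢j))
      x' = to⁻ (inj₂ (edge k o k≢o))
      yx : Adj y x
      yx = Equivalence.from (φ-adj y x)
             (subst₂ SAdj (sym ty) (sym (to∘to⁻ _)) (Equivalence.from (∈-edge i≢j) (inj₁ refl)))
      ex : color x ≡ true
      ex = Y'-neighbour ey yx
    ... | m , m≤3 , walk =
      edge-vertices-far disjoint
        (subst₂ (Walk SAdj m) (to∘to⁻ _) (to∘to⁻ _) (walk-map to (λ {u} {v} → Equivalence.to (φ-adj u v)) walk))
        m≤3

    original-valency : ∀ {y i j k} → color y ≡ false → to y ≡ inj₁ i → i ≢ j → i ≢ k → j ≢ k → deg y ≡ 2
    original-valency {y} {i} {j} {k} ey ty i≢j i≢k j≢k = valency-2 ty (ij≢ik ∘ inj₂-injective) nbhd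
      where
      ij≢ik : edge i j i≢j ≢ edge i k i≢k
      ij≢ik eq with Equivalence.to (∈-edge i≢j) (subst (k ∈ₑ_) (sym eq) (Equivalence.from (∈-edge i≢k) (inj₂ refl)))
      ... | inj₁ k≡i = i≢k (sym k≡i)
      ... | inj₂ k≡j = j≢k (sym k≡j)
      no-fourth : ∀ {o} → i ≢ o → j ≢ o → k ≢ o → ⊥
      no-fourth {o} i≢o j≢o k≢o = disjoint-edges-near i≢j k≢o ey ty disjoint
        where
        disjoint : ∀ {v} → v ∈ₑ edge i j i≢j → v ∈ₑ edge k o k≢o → ⊥
        disjoint v∈ij v∈ko with Equivalence.to (∈-edge i≢j) v∈ij | Equivalence.to (∈-edge k≢o) v∈ko
        ... | inj₁ refl | inj₁ refl = i≢k refl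
        ... | inj₁ refl | inj₂ refl = i≢o refl
        ... | inj₂ refl | inj₁ refl = j≢k refl
        ... | inj₂ refl | inj₂ refl = j≢o refl
      to-pair : ∀ {u} → SAdj (inj₁ i) u → u ≡ inj₂ (edge i j i≢j) ⊎ u ≡ inj₂ (edge i k i≢k)
      to-pair h with original-neighbour h
      ... | o , i≢o , refl with o ≟ j | o ≟ k
      ...   | yes refl | _        = inj₁ refl
      ...   | no _     | yes refl = inj₂ refl
      ...   | no o≢j   | no o≢k   = ⊥-elim (no-fourth i≢o (o≢j ∘ sym) (o≢k ∘ sym))
      nbhd : ∀ {u} → SAdj (inj₁ i) u ⇔ (u ≡ inj₂ (edge i j i≢j) ⊎ u ≡ inj₂ (edge i k i≢k))
      nbhd = mk⇔ to-pair λ { (inj₁ refl) → Equivalence.from (∈-edge i≢j) (inj₁ refl)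
                           ; (inj₂ refl) → Equivalence.from (∈-edge i≢k) (inj₁ refl) }

    Y'-valency : ∀ y → color y ≡ false → deg y ≡ 2
    Y'-valency y ey with to y in ty
    ... | inj₂ ((i , j) , i<j) = valency-2 ty (<⇒≢ i<j ∘ inj₁-injective) edge-vertex-neighbours
    ... | inj₁ i = let _ , _ , i≢j , i≢k , j≢k = two-others 3≤n i in original-valency ey ty i≢j i≢k j≢k

  module Valency₂ (k'≡2 : ∀ y → color y ≡ false → deg y ≡ 2) where

    Y'-other-end : ∀ {z x} → color z ≡ false → Adj z x → ∃[ y ] Exactly₂ (adj z) x y
    Y'-other-end ez = count≡2-other (k'≡2 _ ez)

    Y'-ends : ∀ {z u v} → color z ≡ false → u ≢ v → Adj z u → Adj z v → Exactly₂ (adj z) u v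
    Y'-ends ez = count≡2-exactly₂ (k'≡2 _ ez)

    cN₂ : ∀ {x y} → cN x 2 y ≡ count (λ u → adj x u ∧ adj y u)
    cN₂ {x} {y} = count-cong λ u → cong (_∧ adj y u) (isDist-1 {x} {u})

    geodesic⇒c'₂≡1 : ∀ {x} → color x ≡ true → Geodesic₃ x → c' 2 ≡ 1
    geodesic⇒c'₂≡1 {x} ex g =
      trans (sym (proj₁ (reg-Y' z ez 2 w z-w))) (trans cN₂ (count≡1 (cong₂ _∧_ zt (trans (adj-sym w t) tw)) only-t))
      where
      open Geodesic₃ g
      ez : color z ≡ false
      ez = Y-neighbour ex xz
      z-w : isDist 2 z w ≡ true
      z-w = isDist-2 z≢w (same-color⇒nonadjacent (trans ez (sym (color-at-distance 3 {x} {w} ex x-w)))) zt tw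
        where
        z≢w : z ≢ w
        z≢w z≡w with () ← isDist-unique {1} {3} {x} {w} (subst (λ s → isDist 1 x s ≡ true) z≡w (trans isDist-1 xz)) x-w
      only-t : ∀ u → adj z u ∧ adj w u ≡ true → u ≡ t
      only-t u zu∧wu with ∧≡true {adj z u} zu∧wu
      ... | zu , wu with Exactly₂.only (Y'-ends ez (t≢x ∘ sym) (trans (adj-sym z x) xz) zt) u zu
      ...   | inj₁ refl = ⊥-elim (not-both (trans (adj-sym x w) wu) (cong not x≁w))
      ...   | inj₂ u≡t  = u≡t

    c'₂≡1 : c' 2 ≡ 1
    c'₂≡1 = let x , ex = Y-nonempty in geodesic⇒c'₂≡1 ex (geodesic₃ ex)

    twins⇒c'₂≡2 : ∀ {z z' u v} → color z ≡ false → color z' ≡ false → z ≢ z' → u ≢ v →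
                  Adj z u → Adj z v → Adj z' u → Adj z' v → c' 2 ≡ 2
    twins⇒c'₂≡2 {z} {z'} {u} {v} ez ez' z≢z' u≢v zu zv z'u z'v =
      trans (sym (proj₁ (reg-Y' z ez 2 z' z-z')))
            (trans cN₂ (count-exactly₂ (exactly₂ u≢v (cong₂ _∧_ zu z'u) (cong₂ _∧_ zv z'v) only)))
      where
      z-z' : isDist 2 z z' ≡ true
      z-z' = isDist-2 z≢z' (same-color⇒nonadjacent (trans ez (sym ez'))) zu (trans (adj-sym u z') z'u)
      only : ∀ w → adj z w ∧ adj z' w ≡ true → w ≡ u ⊎ w ≡ v
      only w e = Exactly₂.only (Y'-ends ez' u≢v z'u z'v) w (proj₂ (∧≡true {adj z w} e))

    Y'-twins : ∀ {z z' u v} → color z ≡ false → color z' ≡ false → u ≢ v →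
               Adj z u → Adj z v → Adj z' u → Adj z' v → z ≡ z'
    Y'-twins {z} {z'} ez ez' u≢v zu zv z'u z'v with z ≟ z'
    ... | yes z≡z' = z≡z'
    ... | no z≢z'  = ⊥-elim (1+n≢n (trans (sym (twins⇒c'₂≡2 ez ez' z≢z' u≢v zu zv z'u z'v)) c'₂≡1))

    open Enumeration (enumerate color)

    module AsEdge {z : Fin N} (ez : color z ≡ false) where
      first-end : ∃[ u ] Adj z u
      first-end = count-witness (adj z) (k'≡2 z ez)

      u₀ v₀ : Fin N
      u₀ = proj₁ first-end
      v₀ = proj₁ (Y'-other-end ez (proj₂ first-end))

      ends : Exactly₂ (adj z) u₀ v₀
      ends = proj₂ (Y'-other-end ez (proj₂ first-end))
      open Exactly₂ ends

      edgeOf : Edge size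
      edgeOf = edge (index u₀ (Y'-neighbour ez holds₁)) (index v₀ (Y'-neighbour ez holds₂)) (distinct ∘ index-injective)

      ∈-edgeOf : ∀ {u} .(eu : color u ≡ true) → index u eu ∈ₑ edgeOf ⇔ Adj z u
      ∈-edgeOf {u} eu = mk⇔ (adjacent ∘ Equivalence.to (∈-edge _))
                            (Equivalence.from (∈-edge _) ∘ Sum.map index-cong index-cong ∘ only u)
        where
        adjacent : index u eu ≡ index u₀ _ ⊎ index u eu ≡ index v₀ _ → Adj z u
        adjacent (inj₁ eq) = subst (Adj z) (sym (index-injective eq)) holds₁
        adjacent (inj₂ eq) = subst (Adj z) (sym (index-injective eq)) holds₂

    open AsEdge using (edgeOf; ∈-edgeOf)

    vertexOf : ∀ x c → color x ≡ c → SV size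
    vertexOf x true  ex = inj₁ (index x ex)
    vertexOf x false ex = inj₂ (edgeOf ex)

    ψ : Fin N → SV size
    ψ x = vertexOf x (color x) refl

    ψ≡vertexOf : ∀ x {c} (ex : color x ≡ c) → ψ x ≡ vertexOf x c ex
    ψ≡vertexOf x refl = refl

    data View (x : Fin N) : SV size → Set where
      original    : (ex : color x ≡ true)  → View x (inj₁ (index x ex))
      subdivision : (ex : color x ≡ false) → View x (inj₂ (edgeOf ex))

    view : ∀ x → View x (ψ x)
    view x = view′ (color x) refl
      where
      view′ : ∀ c (ex : color x ≡ c) → View x (vertexOf x c ex)
      view′ true  ex = original ex
      view′ false ex = subdivision ex

    ψ-adj : ∀ x y → Adj x y ⇔ SAdj (ψ x) (ψ y)
    ψ-adj x y with ψ x | view x | ψ y | view y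
    ... | _ | original ex    | _ | original ey    = mk⇔ (λ xy → ⊥-elim (bipartite x y xy (trans ex (sym ey)))) λ ()
    ... | _ | subdivision ex | _ | subdivision ey = mk⇔ (λ xy → ⊥-elim (bipartite x y xy (trans ex (sym ey)))) λ ()
    ... | _ | original ex    | _ | subdivision ey =
      mk⇔ (λ xy → Equivalence.from (∈-edgeOf ey ex) (trans (adj-sym y x) xy))
          (λ h → trans (adj-sym x y) (Equivalence.to (∈-edgeOf ey ex) h))
    ... | _ | subdivision ex | _ | original ey =
      mk⇔ (λ xy → SAdj-sym {s = inj₁ (index y ey)} {inj₂ (edgeOf ex)} (Equivalence.from (∈-edgeOf ex ey) xy))
          (λ h → Equivalence.to (∈-edgeOf ex ey) (SAdj-sym {s = inj₂ (edgeOf ex)} {inj₁ (index y ey)} h))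

    ψ-injective : ∀ {x y} → ψ x ≡ ψ y → x ≡ y
    ψ-injective {x} {y} with ψ x | view x | ψ y | view y
    ... | _ | original _     | _ | original _     = index-injective ∘ inj₁-injective
    ... | _ | original _     | _ | subdivision _  = λ ()
    ... | _ | subdivision _  | _ | original _     = λ ()
    ... | _ | subdivision ex | _ | subdivision ey = λ eq →
      Y'-twins ex ey distinct holds₁ holds₂ (shared (inj₂-injective eq) holds₁) (shared (inj₂-injective eq) holds₂)
      where
      open Exactly₂ (AsEdge.ends ex)
      shared : ∀ {u} → edgeOf ex ≡ edgeOf ey → Adj x u → Adj y u
      shared {u} eq xu = Equivalence.to (∈-edgeOf ey eu) (subst (index u eu ∈ₑ_) eq (Equivalence.from (∈-edgeOf ex eu) xu))
        where
        eu : color u ≡ true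
        eu = Y'-neighbour ex xu

    ψ-surjective : ∀ s → ∃[ x ] ψ x ≡ s
    ψ-surjective (inj₁ i) = element i , trans (ψ≡vertexOf (element i) (element-holds i)) (cong inj₁ (index-element i))
    ψ-surjective (inj₂ e@((i , j) , i<j)) = z , trans (ψ≡vertexOf z ez) (cong inj₂ edgeOf≡e)
      where
      i≢j : i ≢ j
      i≢j = <⇒≢ i<j
      midpoint : ∃[ z ] Adj (element i) z × Adj z (element j)
      midpoint with isDist⇒walk {2} {element i} {element j}
                      (Y-Y-distance (element-holds i) (element-holds j) (i≢j ∘ element-injective))
      ... | [] ▷ uz ▷ zv = _ , uz , zv
      z : Fin N
      z = proj₁ midpoint
      ez : color z ≡ false
      ez = Y-neighbour (element-holds i) (proj₁ (proj₂ midpoint))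
      end : ∀ {k} → Adj z (element k) → k ∈ₑ edgeOf ez
      end {k} zk = subst (_∈ₑ edgeOf ez) (index-element k) (Equivalence.from (∈-edgeOf ez (element-holds k)) zk)
      edgeOf≡e : edgeOf ez ≡ e
      edgeOf≡e = trans (edge-unique i≢j (end (trans (adj-sym z _) (proj₁ (proj₂ midpoint))))
                                          (end (proj₂ (proj₂ midpoint))))
                       (sym (edge-unique i≢j (inj₁ refl) (inj₂ refl)))

    geodesic⇒3≤size : ∀ {x} → color x ≡ true → Geodesic₃ x → 3 ≤ size
    geodesic⇒3≤size {x} ex g = three-distinct⇒3≤ (x≢end holds₁) (x≢end holds₂) (distinct ∘ index-injective)
      where
      open Geodesic₃ g
      ew : color w ≡ false
      ew = color-at-distance 3 {x} {w} ex x-w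
      open Exactly₂ (AsEdge.ends ew)
      x≢end : ∀ {u} (wu : Adj w u) → index x ex ≢ index u (Y'-neighbour ew wu)
      x≢end wu eq with index-injective eq
      ... | refl = not-both (trans (adj-sym x w) wu) (cong not x≁w)

    subdivision-of-complete :
      ∃[ n ] 3 ≤ n × Σ (Fin N ⤖ SV n) λ φ → ∀ x y → Adj x y ⇔ SAdj (Bijection.to φ x) (Bijection.to φ y)
    subdivision-of-complete = size , 3≤size , mk⤖ (ψ-injective , ψ-surjective′) , ψ-adj
      where
      3≤size : 3 ≤ size
      3≤size = let x , ex = Y-nonempty in geodesic⇒3≤size ex (geodesic₃ ex)
      ψ-surjective′ : ∀ s → ∃[ x ] ∀ {x′} → x′ ≡ x → ψ x′ ≡ s
      ψ-surjective′ s = proj₁ (ψ-surjective s) , λ { refl → proj₂ (ψ-surjective s) }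

    b₀≡deg : ∀ {x} → color x ≡ true → b 0 ≡ deg x
    b₀≡deg {x} ex = trans (sym (proj₂ (proj₂ (reg-Y x ex 0 x isDist-0-refl))))
                          (count-cong λ u → trans (cong (_∧ adj x u) (isDist-1 {x} {u})) (∧-idem (adj x u)))

    module Array {x} (ex : color x ≡ true) (g : Geodesic₃ x) where
      open Geodesic₃ g
      open ≡-Reasoning

      ez : color z ≡ false
      ez = Y-neighbour ex xz
      et : color t ≡ true
      et = Y'-neighbour ez zt
      ew : color w ≡ false
      ew = color-at-distance 3 {x} {w} ex x-w
      zx : Adj z x
      zx = trans (adj-sym z x) xz
      x-z : isDist 1 x z ≡ true
      x-z = trans (isDist-1 {x} {z}) xz
      x-t : isDist 2 x t ≡ true
      x-t = Y-Y-distance ex et (t≢x ∘ sym)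

      c₁≡1 : c 1 ≡ 1
      c₁≡1 = trans (sym (proj₁ (reg-Y x ex 1 z x-z)))
                   (count≡1 (cong₂ _∧_ (isDist-0-refl {x}) zx) λ u e → sym (isDist-0 (proj₁ (∧≡true {isDist 0 x u} e))))

      b₁≡1 : b 1 ≡ 1
      b₁≡1 = trans (sym (proj₂ (proj₂ (reg-Y x ex 1 z x-z)))) (count≡1 (cong₂ _∧_ x-t zt) only-t)
        where
        only-t : ∀ u → isDist 2 x u ∧ adj z u ≡ true → u ≡ t
        only-t u e with ∧≡true {isDist 2 x u} e
        ... | x-u , zu with Exactly₂.only (Y'-ends ez (t≢x ∘ sym) zx zt) u zu
        ...   | inj₁ u≡x = ⊥-elim (isDist-suc⇒≢ {1} {x} {u} x-u (sym u≡x))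
        ...   | inj₂ u≡t = u≡t

      common-x-t : cN x 2 t ≡ 1
      common-x-t = trans cN₂ (count≡1 (cong₂ _∧_ xz (trans (adj-sym t z) zt)) only-z)
        where
        only-z : ∀ u → adj x u ∧ adj t u ≡ true → u ≡ z
        only-z u e with ∧≡true {adj x u} e
        ... | xu , tu = Y'-twins (Y-neighbour ex xu) ez (t≢x ∘ sym) (trans (adj-sym u x) xu) (trans (adj-sym u t) tu) zx zt

      c₂≡1 : c 2 ≡ 1
      c₂≡1 = trans (sym (proj₁ (reg-Y x ex 2 t x-t))) common-x-t

      b₂≡deg∸1 : b 2 ≡ deg x ∸ 1
      b₂≡deg∸1 = begin
        b 2                ≡⟨ sym (proj₂ (proj₂ (reg-Y x ex 2 t x-t))) ⟩
        bN x 2 t           ≡⟨ sym (m+n∸m≡n 1 (bN x 2 t)) ⟩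
        1 + bN x 2 t ∸ 1   ≡⟨ cong (_∸ 1) deg-t ⟩
        deg t ∸ 1          ≡⟨ cong (_∸ 1) (trans (sym (b₀≡deg et)) (b₀≡deg ex)) ⟩
        deg x ∸ 1          ∎
        where
        beyond-x : ∀ u → adj t u ∧ not (isDist 1 x u) ≡ isDist 3 x u ∧ adj t u
        beyond-x u = ⇔→≡ (mk⇔ to-far to-near)
          where
          to-far : adj t u ∧ not (isDist 1 x u) ≡ true → isDist 3 x u ∧ adj t u ≡ true
          to-far e with ∧≡true {adj t u} e
          ... | tu , x≁u with Y-Y'-distance ex (Y-neighbour et tu)
          ...   | inj₁ x-u = ⊥-elim (not-both x-u x≁u)
          ...   | inj₂ x-u = cong₂ _∧_ x-u tu
          to-near : isDist 3 x u ∧ adj t u ≡ true → adj t u ∧ not (isDist 1 x u) ≡ true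
          to-near e with ∧≡true {isDist 3 x u} e
          ... | x-u , tu = cong₂ _∧_ tu (cong not (¬-not λ x-u₁ → m≢1+m+n 1 (isDist-unique {1} {3} {x} {u} x-u₁ x-u)))
        deg-t : 1 + bN x 2 t ≡ deg t
        deg-t = sym (trans (count-split (adj t) (isDist 1 x))
                           (cong₂ _+_ (trans (count-cong λ u → ∧-comm (adj t u) (isDist 1 x u)) common-x-t)
                                      (count-cong beyond-x)))

      c₃≡2 : c 3 ≡ 2
      c₃≡2 = trans (sym (proj₁ (reg-Y x ex 3 w x-w))) (trans (count-cong at-distance-2) (k'≡2 w ew))
        where
        at-distance-2 : ∀ u → isDist 2 x u ∧ adj w u ≡ adj w u
        at-distance-2 u = ⇔→≡ (mk⇔ (proj₂ ∘ ∧≡true {isDist 2 x u})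
                                  λ wu → cong₂ _∧_ (Y-Y-distance ex (Y'-neighbour ew wu) (x≢ wu)) wu)
          where
          x≢ : Adj w u → x ≢ u
          x≢ wu refl = not-both (trans (adj-sym x w) wu) (cong not x≁w)

    intersection-array : ∀ x → color x ≡ true →
      (b 0 ≡ deg x) × (b 1 ≡ 1) × (b 2 ≡ deg x ∸ 1) × (c 1 ≡ 1) × (c 2 ≡ 1) × (c 3 ≡ 2)
    intersection-array x ex = b₀≡deg ex , b₁≡1 , b₂≡deg∸1 , c₁≡1 , c₂≡1 , c₃≡2
      where open Array ex (geodesic₃ ex)

    two-Y-homogeneous : TwoYHomogeneous Δ
    two-Y-homogeneous 1 _ _ = 1 , λ x y z _ _ x-z y-z →
      count≡1 (cong₂ _∧_ (isDist-0-refl {z})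
                         (cong₂ _∧_ (trans (sym (isDist-1 {x} {z})) x-z) (trans (sym (isDist-1 {y} {z})) y-z)))
              λ u e → sym (isDist-0 (proj₁ (∧≡true {isDist 0 z u} e)))
    two-Y-homogeneous 2 _ _ = 0 , λ x y z ex x-y x-z y-z → count-none λ u →
      ∧≡false λ z-u xu∧yu → let xu , yu = ∧≡true {adj x u} xu∧yu in
        case Exactly₂.only (Y'-ends (Y-neighbour ex xu) (isDist-suc⇒≢ {1} {x} {y} x-y)
                                    (trans (adj-sym u x) xu) (trans (adj-sym u y) yu))
                           z (trans (adj-sym u z) (trans (sym (isDist-1 {z} {u})) z-u)) of λ where
          (inj₁ z≡x) → isDist-suc⇒≢ {1} {x} {z} x-z (sym z≡x)
          (inj₂ z≡y) → isDist-suc⇒≢ {1} {y} {z} y-z (sym z≡y)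
    two-Y-homogeneous (suc (suc (suc i))) _ 4+i≤D with subst (suc (suc (suc (suc i))) ≤_) D≡3 4+i≤D
    ... | s≤s (s≤s (s≤s ()))

proposition4p1 : ∀ {N : ℕ} (G : Graph N) (Δ : DistanceBiregular G) →
  (∀ x → DistanceBiregular.color Δ x ≡ true → GraphOps.Ecc G x 3) →
  ((∃[ n ] (3 ≤ n) × (Σ (Fin N ⤖ SV n) λ φ → (∀ x y → Graph.adj G x y ≡ true ⇔ SAdj {n} (Bijection.to φ x) (Bijection.to φ y)) ))
    ⇔ (∀ y → DistanceBiregular.color Δ y ≡ false → GraphOps.deg G y ≡ 2))
  × (∀ n → 3 ≤ n → (φ : Fin N ⤖ SV n) →
       (∀ x y → Graph.adj G x y ≡ true ⇔ SAdj (Bijection.to φ x) (Bijection.to φ y)) →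
       (∀ x → isOriginal (Bijection.to φ x) ≡ DistanceBiregular.color Δ x) →
       (∀ y → DistanceBiregular.color Δ y ≡ false → GraphOps.deg G y ≡ 2) →
       TwoYHomogeneous Δ
       × (∀ x → DistanceBiregular.color Δ x ≡ true →
            (DistanceBiregular.b Δ 0 ≡ GraphOps.deg G x)
            × (DistanceBiregular.b Δ 1 ≡ 1)
            × (DistanceBiregular.b Δ 2 ≡ GraphOps.deg G x ∸ 1)
            × (DistanceBiregular.c Δ 1 ≡ 1)
            × (DistanceBiregular.c Δ 2 ≡ 1)
            × (DistanceBiregular.c Δ 3 ≡ 2)))
proposition4p1 G Δ ecc₃ =
  mk⇔ (λ { (_ , 3≤n , φ , φ-adj) → FromSubdivision.Y'-valency 3≤n φ φ-adj })
      Valency₂.subdivision-of-complete ,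
  λ _ _ _ _ _ k'≡2 → Valency₂.two-Y-homogeneous k'≡2 , Valency₂.intersection-array k'≡2
  where
  open Eccentricity₃ G Δ ecc₃
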